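{- Let $G$ and $H$ be connected graphs such that at least one of $G$, $H$ has at least three vertices. If $(u_1,v_1)$ and $(u_2,v_2)$ are adjacent vertices of $G\times H$, then $N[(u_1,v_1)]\neq N[(u_2,v_2)]$.
   Context: $N[x]$ denotes the closed neighborhood of a vertex $x$ (the vertex together with all its neighbors). The tensor product $G\times H$ has vertex set $V(G)\times V(H)$, where $(u_1,v_1)$ and $(u_2,v_2)$ are adjacent iff $u_1u_2\in E(G)$ and $v_1v_2\in E(H)$. -}

module Defs where

open import Level using (0ℓ)
open import Data.Nat using (ℕ; suc)
open import Data.Fin using (Fin)
open import Data.Product using (_×_; _,_)
open import Data.Sum using (_⊎_)
open import Relation.Nullary using (¬_)
open import Relation.Binary.PropositionalEquality using (_≡_)

record Graph (n : ℕ) : Set₁ where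
  field
    Adj   : Fin n → Fin n → Set
    irrefl : ∀ x → ¬ Adj x x
    sym   : ∀ {x y} → Adj x y → Adj y x
open Graph public

data Walk {n : ℕ} (G : Graph n) : Fin n → Fin n → Set where
  here : ∀ {x} → Walk G x x
  step : ∀ {x y z} → Adj G x y → Walk G y z → Walk G x z

Connected : ∀ {n} → Graph n → Set
Connected {n} G = (x y : Fin n) → Walk G x y

TensorAdj : ∀ {m n} → Graph m → Graph n → (Fin m × Fin n) → (Fin m × Fin n) → Set
TensorAdj G H (u₁ , v₁) (u₂ , v₂) = Adj G u₁ u₂ × Adj H v₁ v₂

ClosedNbhd : ∀ {m n} → Graph m → Graph n → (Fin m × Fin n) → (Fin m × Fin n) → Set
ClosedNbhd G H x z = (z ≡ x) ⊎ TensorAdj G H x z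

SameClosedNbhd : ∀ {m n} → Graph m → Graph n → (Fin m × Fin n) → (Fin m × Fin n) → Set
SameClosedNbhd {m} {n} G H x y =
  (z : Fin m × Fin n) → (ClosedNbhd G H x z → ClosedNbhd G H y z) × (ClosedNbhd G H y z → ClosedNbhd G H x z)

{-# OPTIONS --safe #-}
module Submission where

-- Suppose G is connected with at least three vertices and v₁v₂ ∈ E(H). Connectivity gives
-- a vertex w ∉ {u₁, u₂} adjacent to one of them, say u₁. Then (w, v₂) is adjacent to
-- (u₁, v₁), but it is neither equal to (u₂, v₂) (as w ≠ u₂) nor adjacent to it (as H has
-- no loop at v₂). The case n ≥ 3 is the same argument with the factors swapped.

open import Defs
open import Data.Nat using (ℕ; _≥_; s≤s)
open import Data.Fin using (Fin; zero; suc)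
open import Data.Fin.Properties using (_≟_)
open import Data.Product using (_×_; _,_; ∃; proj₁; proj₂; swap)
open import Data.Sum using (_⊎_; inj₁; inj₂)
open import Data.Empty using (⊥-elim)
open import Relation.Nullary using (¬_; yes; no)
open import Relation.Binary.PropositionalEquality using (_≡_; _≢_; refl; cong)

Outside : ∀ {m} → Fin m → Fin m → Fin m → Set
Outside a b w = w ≢ a × w ≢ b

outside-pair : ∀ {m} → m ≥ 3 → (a b : Fin m) → ∃ (Outside a b)
outside-pair (s≤s (s≤s (s≤s _))) a b with zero ≟ a | zero ≟ b
... | no 0≢a     | no 0≢b = zero , 0≢a , 0≢b
... | yes refl   | _ with suc zero ≟ b
...   | no 1≢b   = suc zero , (λ ()) , 1≢b
...   | yes refl = suc (suc zero) , (λ ()) , (λ ())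
outside-pair (s≤s (s≤s (s≤s _))) a b | no _ | yes refl with suc zero ≟ a
...   | no 1≢a   = suc zero , 1≢a , (λ ())
...   | yes refl = suc (suc zero) , (λ ()) , (λ ())

walk-leaves-pair : ∀ {m} (G : Graph m) {a b c x : Fin m} →
  c ≡ a ⊎ c ≡ b → Outside a b x → Walk G c x →
  ∃ λ w → (Adj G a w ⊎ Adj G b w) × Outside a b w
walk-leaves-pair G (inj₁ refl) (x≢a , _) here = ⊥-elim (x≢a refl)
walk-leaves-pair G (inj₂ refl) (_ , x≢b) here = ⊥-elim (x≢b refl)
walk-leaves-pair G {a} {b} c∈ab x∉ab (step {y = y} cy walk) with y ≟ a | y ≟ b
... | yes y≡a | _       = walk-leaves-pair G (inj₁ y≡a) x∉ab walk
... | no _    | yes y≡b = walk-leaves-pair G (inj₂ y≡b) x∉ab walk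
... | no y≢a  | no y≢b with c∈ab
...   | inj₁ refl = y , inj₁ cy , y≢a , y≢b
...   | inj₂ refl = y , inj₂ cy , y≢a , y≢b

neighbour-outside-pair : ∀ {m} (G : Graph m) → Connected G → m ≥ 3 → (a b : Fin m) →
  ∃ λ w → (Adj G a w ⊎ Adj G b w) × Outside a b w
neighbour-outside-pair G connected m≥3 a b =
  let x , x∉ab = outside-pair m≥3 a b
  in  walk-leaves-pair G (inj₁ refl) x∉ab (connected a x)

module _ {m n : ℕ} (G : Graph m) (H : Graph n) where

  sameClosedNbhd-sym : ∀ {x y} → SameClosedNbhd G H x y → SameClosedNbhd G H y x
  sameClosedNbhd-sym same z = swap (same z)

  separated : ∀ {x y z} → ClosedNbhd G H x z → ¬ ClosedNbhd G H y z → ¬ SameClosedNbhd G H x y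
  separated z∈Nx z∉Ny same = z∉Ny (proj₁ (same _) z∈Nx)

  private-neighbour : ∀ {u₁ u₂ w v₁ v₂} → Adj G u₁ w → w ≢ u₂ → Adj H v₁ v₂ →
    ClosedNbhd G H (u₁ , v₁) (w , v₂) × ¬ ClosedNbhd G H (u₂ , v₂) (w , v₂)
  private-neighbour {u₂ = u₂} {w} {v₂ = v₂} u₁w w≢u₂ v₁v₂ = inj₂ (u₁w , v₁v₂) , excluded
    where
    excluded : ¬ ClosedNbhd G H (u₂ , v₂) (w , v₂)
    excluded (inj₁ eq)         = w≢u₂ (cong proj₁ eq)
    excluded (inj₂ (_ , v₂v₂)) = irrefl H v₂ v₂v₂

  distinct-nbhds-left : Connected G → m ≥ 3 → ∀ {u₁ u₂ v₁ v₂} → Adj H v₁ v₂ →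
    ¬ SameClosedNbhd G H (u₁ , v₁) (u₂ , v₂)
  distinct-nbhds-left connected m≥3 {u₁} {u₂} v₁v₂
    with neighbour-outside-pair G connected m≥3 u₁ u₂
  ... | w , inj₁ u₁w , _ , w≢u₂ =
    let z∈N₁ , z∉N₂ = private-neighbour u₁w w≢u₂ v₁v₂
    in  separated z∈N₁ z∉N₂
  ... | w , inj₂ u₂w , w≢u₁ , _ =
    let z∈N₂ , z∉N₁ = private-neighbour u₂w w≢u₁ (sym H v₁v₂)
    in  λ same → separated z∈N₂ z∉N₁ (sameClosedNbhd-sym same)

closedNbhd-swap : ∀ {m n} (G : Graph m) (H : Graph n) {x z : Fin m × Fin n} →
  ClosedNbhd G H x z → ClosedNbhd H G (swap x) (swap z)
closedNbhd-swap G H (inj₁ eq)  = inj₁ (cong swap eq)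
closedNbhd-swap G H (inj₂ adj) = inj₂ (swap adj)

sameClosedNbhd-swap : ∀ {m n} (G : Graph m) (H : Graph n) {x y : Fin m × Fin n} →
  SameClosedNbhd G H x y → SameClosedNbhd H G (swap x) (swap y)
sameClosedNbhd-swap G H same (b , a) =
  let to , from = same (a , b)
  in  (λ z∈Nx → closedNbhd-swap G H (to (closedNbhd-swap H G z∈Nx)))
    , (λ z∈Ny → closedNbhd-swap G H (from (closedNbhd-swap H G z∈Ny)))

lemma14 : {m n : ℕ} (G : Graph m) (H : Graph n) →
    Connected G → Connected H → (m ≥ 3 ⊎ n ≥ 3) →
    (u₁ u₂ : Fin m) (v₁ v₂ : Fin n) →
    TensorAdj G H (u₁ , v₁) (u₂ , v₂) →
    ¬ SameClosedNbhd G H (u₁ , v₁) (u₂ , v₂)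
lemma14 G H cG cH (inj₁ m≥3) u₁ u₂ v₁ v₂ (_ , v₁v₂) =
  distinct-nbhds-left G H cG m≥3 v₁v₂
lemma14 G H cG cH (inj₂ n≥3) u₁ u₂ v₁ v₂ (u₁u₂ , _) same =
  distinct-nbhds-left H G cH n≥3 u₁u₂ (sameClosedNbhd-swap G H same)
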